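{- Let ${\cal F}$ be a Fano plane, $\epsilon$ a composition factor, $P\in{\cal F}$, $D_1,D_2,D_3$ the three lines through $P$, and $g\in\mathrm{Aut}({\cal F})$. Then $\delta^\ast(g,D_1)\delta^\ast(g,D_2)\delta^\ast(g,D_3)=1$.
   Context: ${\cal F}$ is a Fano plane (seven points, seven lines), $\mathrm{Aut}({\cal F})$ the group of bijections sending lines to lines; for distinct $P,Q$, $P+Q$ is the third point on their line. $\mathbb F$ is a field of characteristic not 2, $\mathbb O_{\cal F}$ has basis $1,e_P$. A multiplication factor $\epsilon$ assigns $\epsilon_{PQ}\in\{\pm1\}$ to distinct $P,Q$ with $\epsilon_{QP}=-\epsilon_{PQ}$, defining the product with unit $1$, $e_Pe_Q=\epsilon_{PQ}e_{P+Q}$, $e_P^2=-1$; it is a composition factor if $N(\lambda^01+\sum\lambda^Pe_P)=(\lambda^0)^2+\sum(\lambda^P)^2$ is multiplicative. For a line $D$, $\delta^\ast(g,D)=\epsilon_{AB}\epsilon_{g(A)g(B)}$ for any distinct $A,B\in D$ (independent of the choice). -}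

module Defs where

open import Level using (Level; _⊔_; suc)
import Data.Nat as ℕ
open import Data.Fin using (Fin)
import Data.Fin as Fin
open import Data.Fin.Properties using (any?)
open import Data.Fin.Subset using (Subset; _∈_; ∣_∣)
open import Data.Fin.Subset.Properties using (_∈?_)
open import Data.Product using (Σ; ∃; _×_; _,_)
open import Data.Sign using (Sign)
import Data.Sign as Sign
open import Relation.Nullary using (¬_; Dec; yes; no; _×-dec_)
open import Relation.Binary.PropositionalEquality using (_≡_; _≢_)
open import Algebra.Bundles using (CommutativeRing)

record Field (c ℓ : Level) : Set (Level.suc (c ⊔ ℓ)) where
  field
    commRing : CommutativeRing c ℓ
  open CommutativeRing commRing public
  field
    1≉0     : ¬ (1# ≈ 0#)
    inverse : ∀ x → ¬ (x ≈ 0#) → Σ Carrier (λ y → x * y ≈ 1#)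

CharNot2 : ∀ {c ℓ} → Field c ℓ → Set ℓ
CharNot2 𝔽 = ¬ (1# + 1# ≈ 0#) where open Field 𝔽

Point : Set
Point = Fin 7

record FanoPlane : Set where
  field
    line        : Fin 7 → Subset 7
    line-size   : ∀ i → ∣ line i ∣ ≡ 3
    unique-line : ∀ (P Q : Point) → P ≢ Q →
                  Σ (Fin 7) λ i → (P ∈ line i × Q ∈ line i) ×
                    (∀ j → P ∈ line j → Q ∈ line j → j ≡ i)

  IsSum : Point → Point → Point → Set
  IsSum P Q R = (P ≢ Q) × (R ≢ P) × (R ≢ Q) ×
                ∃ λ i → P ∈ line i × Q ∈ line i × R ∈ line i

  isSum? : ∀ P Q R → Dec (IsSum P Q R)
  isSum? P Q R =
    ¬? (P Data.Fin.≟ Q) ×-dec ¬? (R Data.Fin.≟ P) ×-dec ¬? (R Data.Fin.≟ Q) ×-dec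
    any? (λ i → (P ∈? line i) ×-dec (Q ∈? line i) ×-dec (R ∈? line i))
    where open import Relation.Nullary using (¬?)

record Aut (Π : FanoPlane) : Set where
  open FanoPlane Π
  field
    g        : Point → Point
    g⁻¹      : Point → Point
    g⁻¹∘g    : ∀ P → g⁻¹ (g P) ≡ P
    g∘g⁻¹    : ∀ P → g (g⁻¹ P) ≡ P
    line→line : ∀ i → Σ (Fin 7) λ j → ∀ Q →
                  (Q ∈ line j → Σ Point λ P → P ∈ line i × g P ≡ Q) ×
                  ((Σ Point λ P → P ∈ line i × g P ≡ Q) → Q ∈ line j)

-- Multiplication factors (values on the diagonal are irrelevant).

IsMultiplicationFactor : (Point → Point → Sign) → Set
IsMultiplicationFactor ε = ∀ P Q → P ≢ Q → ε Q P ≡ Sign.opposite (ε P Q)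

module _ {c ℓ} (𝔽 : Field c ℓ) where
  open Field 𝔽 using (Carrier; _≈_; _+_; _*_; -_; _-_; 0#; 1#)

  sumFin : ∀ n → (Fin n → Carrier) → Carrier
  sumFin ℕ.zero    f = 0#
  sumFin (ℕ.suc n) f = f Fin.zero + sumFin n (λ i → f (Fin.suc i))

  signF : Sign → Carrier
  signF Sign.+ = 1#
  signF Sign.- = - 1#

  -- elements λ⁰ 1 + Σ λᴾ eₚ of 𝕆_F
  record Oct : Set c where
    constructor oct
    field
      re : Carrier
      im : Point → Carrier
  open Oct

  module _ (Π : FanoPlane) (ε : Point → Point → Sign) where
    open FanoPlane Π

    structConst : Point → Point → Point → Carrier
    structConst P Q R with isSum? P Q R
    ... | yes _ = signF (ε P Q)
    ... | no  _ = 0#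

    -- product determined by: 1 unit, eₚ eQ = εₚQ e_{P+Q}, eₚ² = -1
    _·_ : Oct → Oct → Oct
    x · y = oct
      (re x * re y - sumFin 7 (λ P → im x P * im y P))
      (λ R → re x * im y R + im x R * re y +
             sumFin 7 (λ P → sumFin 7 (λ Q → structConst P Q R * (im x P * im y Q))))

    N : Oct → Carrier
    N x = re x * re x + sumFin 7 (λ P → im x P * im x P)

    IsCompositionFactor : Set (c ⊔ ℓ)
    IsCompositionFactor = ∀ x y → N (x · y) ≈ N x * N y

-- δ*(g, D) computed from a chosen pair of distinct points A, B of D.

δ* : ∀ {Π} → (Point → Point → Sign) → Aut Π → Point → Point → Sign
δ* ε g A B = ε A B Sign.* ε (Aut.g g A) (Aut.g g B)

{-# OPTIONS --safe #-}
module Submission where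

-- For a line D through P and any X ≠ P on D, δ*(g, D) = ε_PX ε_gPgX: on a line ε is an
-- orientation (rotating A, B, A + B keeps ε_AB, swapping negates it) and g preserves lines and sums.
-- Taking X, Y on two of the lines through P, X + Y lies on the third, so the product of the three
-- δ* is σ(P, X, Y) σ(gP, gX, gY) with σ(P, X, Y) = ε_PX ε_PY ε_P(X+Y).  Multiplicativity of the
-- norm on (e_A + e_B)(1 + e_C) gives the orientation property, and on (e_A + e_B)(e_C + e_D) a
-- sign rule for quadrangles; together they make σ invariant under swapping or rotating X, Y,
-- under Y ↦ P + Y and under P ↦ P + X + Y.  These moves connect any two non-collinear triples
-- (three non-collinear points span all seven points), so σ is constant and the product is 1.

open import Defs
open import Level using (Level)
open import Data.Nat using (ℕ; _≤_)
import Data.Nat.Properties as ℕₚ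
open import Data.Fin using (Fin; zero; suc; _≟_)
open import Data.Fin.Properties using (injective⇒≤; suc-injective)
open import Data.Fin.Subset using (Subset; _∈_)
open import Data.List using (List; []; _∷_; length; lookup)
open import Data.List.Relation.Unary.Any using (here; there; any?)
open import Data.List.Relation.Unary.All using ([]; _∷_)
import Data.List.Relation.Unary.All as All
open import Data.List.Relation.Unary.All.Properties using (¬Any⇒All¬)
open import Data.List.Relation.Unary.AllPairs using ([]; _∷_)
open import Data.List.Relation.Unary.Unique.Propositional using (Unique)
open import Data.List.Membership.Propositional.Properties using (∈-lookup)
open import Data.Product using (∃; _×_; _,_; proj₁; proj₂)
open import Data.Sum using (_⊎_; inj₁; inj₂)
open import Function using (_∘_; Injective)
open import Relation.Nullary using (yes; no; contradiction)
open import Relation.Binary.PropositionalEquality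
  using (_≡_; _≢_; refl; sym; trans; cong; cong₂; subst; ≢-sym; module ≡-Reasoning)
open import Data.Sign using (Sign; opposite)
import Data.Sign as Sign

module _ where
  open import Data.Nat using (suc; _+_)
  open import Data.Fin.Subset using (_∉_; _-_; ∣_∣; inside; outside)
  import Data.Fin.Subset as Subset
  open import Data.Fin.Subset.Properties
    using (p─⊥≡p; p─q⊆p; x∈p∧x≢y⇒x∈p-y; nonempty?; Empty-unique; ∣⊥∣≡0)
  open import Data.Vec using (_∷_; here; there)

  x∈p⇒∣p∣≡1+∣p-x∣ : ∀ {n} {p : Subset n} {x} → x ∈ p → ∣ p ∣ ≡ suc ∣ p - x ∣
  x∈p⇒∣p∣≡1+∣p-x∣ {p = inside  ∷ p} here        = cong (suc ∘ ∣_∣) (sym (p─⊥≡p p))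
  x∈p⇒∣p∣≡1+∣p-x∣ {p = inside  ∷ p} (there x∈p) = cong suc (x∈p⇒∣p∣≡1+∣p-x∣ x∈p)
  x∈p⇒∣p∣≡1+∣p-x∣ {p = outside ∷ p} (there x∈p) = x∈p⇒∣p∣≡1+∣p-x∣ x∈p

  y∉p-y : ∀ {n} (p : Subset n) y → y ∉ p - y
  y∉p-y (inside  ∷ p) zero    ()
  y∉p-y (outside ∷ p) zero    ()
  y∉p-y (inside  ∷ p) (suc y) (there y∈p-y) = y∉p-y p y y∈p-y
  y∉p-y (outside ∷ p) (suc y) (there y∈p-y) = y∉p-y p y y∈p-y

  x∈p-y⇒x≢y : ∀ {n} {p : Subset n} {x y} → x ∈ p - y → x ≢ y
  x∈p-y⇒x≢y x∈p-y refl = y∉p-y _ _ x∈p-y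

  module _ {n} {s : Subset n} (∣s∣≡3 : ∣ s ∣ ≡ 3) where
    open ≡-Reasoning

    third-member : ∀ {a b} → a ∈ s → b ∈ s → a ≢ b → ∃ λ c → c ∈ s × c ≢ a × c ≢ b
    third-member {a} {b} a∈s b∈s a≢b with nonempty? (s - a - b)
    ... | yes (c , c∈s-a-b) =
      c , p─q⊆p s _ (p─q⊆p (s - a) _ c∈s-a-b) , x∈p-y⇒x≢y (p─q⊆p (s - a) _ c∈s-a-b) , x∈p-y⇒x≢y c∈s-a-b
    ... | no empty = contradiction 3≡2 λ ()
      where
      3≡2 : 3 ≡ 2
      3≡2 = begin
        3                     ≡⟨ sym ∣s∣≡3 ⟩
        ∣ s ∣                 ≡⟨ x∈p⇒∣p∣≡1+∣p-x∣ a∈s ⟩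
        1 + ∣ s - a ∣         ≡⟨ cong suc (x∈p⇒∣p∣≡1+∣p-x∣ (x∈p∧x≢y⇒x∈p-y b∈s (≢-sym a≢b))) ⟩
        2 + ∣ s - a - b ∣     ≡⟨ cong (λ t → 2 + ∣ t ∣) (Empty-unique empty) ⟩
        2 + ∣ Subset.⊥ {n} ∣  ≡⟨ cong (2 +_) (∣⊥∣≡0 n) ⟩
        2                     ∎

    members-of-three : ∀ {a b c x} → a ∈ s → b ∈ s → c ∈ s → a ≢ b → a ≢ c → b ≢ c →
                       x ∈ s → x ≡ a ⊎ x ≡ b ⊎ x ≡ c
    members-of-three {a} {b} {c} {x} a∈s b∈s c∈s a≢b a≢c b≢c x∈s with x ≟ a | x ≟ b | x ≟ c
    ... | yes x≡a | _       | _       = inj₁ x≡a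
    ... | no _    | yes x≡b | _       = inj₂ (inj₁ x≡b)
    ... | no _    | no _    | yes x≡c = inj₂ (inj₂ x≡c)
    ... | no x≢a  | no x≢b  | no x≢c  = contradiction 3≡4+ λ ()
      where
      remove : ∀ {y z} {p : Subset n} → y ∈ p → y ≢ z → y ∈ p - z
      remove = x∈p∧x≢y⇒x∈p-y
      3≡4+ : 3 ≡ 4 + ∣ s - a - b - c - x ∣
      3≡4+ = begin
        3                          ≡⟨ sym ∣s∣≡3 ⟩
        ∣ s ∣                      ≡⟨ x∈p⇒∣p∣≡1+∣p-x∣ a∈s ⟩
        1 + ∣ s - a ∣              ≡⟨ cong (1 +_) (x∈p⇒∣p∣≡1+∣p-x∣ (remove b∈s (≢-sym a≢b))) ⟩
        2 + ∣ s - a - b ∣          ≡⟨ cong (2 +_) (x∈p⇒∣p∣≡1+∣p-x∣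
                                        (remove (remove c∈s (≢-sym a≢c)) (≢-sym b≢c))) ⟩
        3 + ∣ s - a - b - c ∣      ≡⟨ cong (3 +_) (x∈p⇒∣p∣≡1+∣p-x∣
                                        (remove (remove (remove x∈s x≢a) x≢b) x≢c)) ⟩
        4 + ∣ s - a - b - c - x ∣  ∎

lookup-injective : ∀ {a} {A : Set a} {xs : List A} → Unique xs → Injective _≡_ _≡_ (lookup xs)
lookup-injective {xs = _ ∷ _} (_ ∷ _) {zero} {zero} _ = refl
lookup-injective {xs = _ ∷ _} (x≢xs ∷ _) {zero} {suc j} eq = contradiction eq (All.lookup x≢xs (∈-lookup j))
lookup-injective {xs = _ ∷ _} (x≢xs ∷ _) {suc i} {zero} eq = contradiction (sym eq) (All.lookup x≢xs (∈-lookup i))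
lookup-injective {xs = _ ∷ _} (_ ∷ xs!) {suc i} {suc j} eq = cong suc (lookup-injective xs! eq)

unique⇒length≤ : ∀ {n} {xs : List (Fin n)} → Unique xs → length xs ≤ n
unique⇒length≤ xs! = injective⇒≤ (lookup-injective xs!)

module FanoGeometry (Π : FanoPlane) where
  open FanoPlane Π

  private variable
    A B C C′ P Q U V X Y Z : Point
    i j k l : Fin 7

  isSum-comm : IsSum A B C → IsSum B A C
  isSum-comm (A≢B , C≢A , C≢B , i , A∈ , B∈ , C∈) = ≢-sym A≢B , C≢B , C≢A , i , B∈ , A∈ , C∈

  isSum-rotate : IsSum A B C → IsSum B C A
  isSum-rotate (A≢B , C≢A , C≢B , i , A∈ , B∈ , C∈) = ≢-sym C≢B , A≢B , ≢-sym C≢A , i , B∈ , C∈ , A∈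

  line-unique : A ≢ B → A ∈ line i → B ∈ line i → A ∈ line j → B ∈ line j → i ≡ j
  line-unique {A} {B} A≢B A∈i B∈i A∈j B∈j with unique-line A B A≢B
  ... | _ , _ , unique = trans (unique _ A∈i B∈i) (sym (unique _ A∈j B∈j))

  isSum-onLine : IsSum A B C → A ∈ line i → B ∈ line i → C ∈ line i
  isSum-onLine (A≢B , _ , _ , j , A∈j , B∈j , C∈j) A∈i B∈i =
    subst (λ k → _ ∈ line k) (line-unique A≢B A∈j B∈j A∈i B∈i) C∈j

  isSum-line-members : IsSum A B C → A ∈ line i → B ∈ line i → X ∈ line i →
                       X ≡ A ⊎ X ≡ B ⊎ X ≡ C
  isSum-line-members {i = i} s@(A≢B , C≢A , C≢B , _) A∈ B∈ =
    members-of-three (line-size i) A∈ B∈ (isSum-onLine s A∈ B∈) A≢B (≢-sym C≢A) (≢-sym C≢B)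

  isSum-functional : IsSum A B C → IsSum A B C′ → C ≡ C′
  isSum-functional s@(_ , _ , _ , _ , A∈ , B∈ , _) s′@(_ , C′≢A , C′≢B , _)
    with isSum-line-members s A∈ B∈ (isSum-onLine s′ A∈ B∈)
  ... | inj₁ C′≡A        = contradiction C′≡A C′≢A
  ... | inj₂ (inj₁ C′≡B) = contradiction C′≡B C′≢B
  ... | inj₂ (inj₂ C′≡C) = sym C′≡C

  third-point : A ≢ B → ∃ (IsSum A B)
  third-point {A} {B} A≢B with unique-line A B A≢B
  ... | i , (A∈ , B∈) , _ with third-member (line-size i) A∈ B∈ A≢B
  ... | C , C∈ , C≢A , C≢B = C , A≢B , C≢A , C≢B , i , A∈ , B∈ , C∈

  -- The junk value A ⊕ A = A makes the cancellation laws below unconditional.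
  infixl 6 _⊕_
  _⊕_ : Point → Point → Point
  A ⊕ B with A ≟ B
  ... | yes _   = A
  ... | no A≢B = proj₁ (third-point A≢B)

  ⊕-cases : ∀ A B → A ≡ B ⊎ IsSum A B (A ⊕ B)
  ⊕-cases A B with A ≟ B
  ... | yes A≡B = inj₁ A≡B
  ... | no A≢B  = inj₂ (proj₂ (third-point A≢B))

  ⊕-idem : ∀ A → A ⊕ A ≡ A
  ⊕-idem A with A ≟ A
  ... | yes _  = refl
  ... | no A≢A = contradiction refl A≢A

  ⊕-isSum : A ≢ B → IsSum A B (A ⊕ B)
  ⊕-isSum {A} {B} A≢B with ⊕-cases A B
  ... | inj₁ A≡B = contradiction A≡B A≢B
  ... | inj₂ s   = s

  isSum⇒⊕≡ : IsSum A B C → A ⊕ B ≡ C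
  isSum⇒⊕≡ s = isSum-functional (⊕-isSum (proj₁ s)) s

  ⊕-comm : ∀ A B → A ⊕ B ≡ B ⊕ A
  ⊕-comm A B with ⊕-cases A B
  ... | inj₁ refl = refl
  ... | inj₂ s    = sym (isSum⇒⊕≡ (isSum-comm s))

  ⊕-cancelˡ : ∀ A B → A ⊕ (A ⊕ B) ≡ B
  ⊕-cancelˡ A B with ⊕-cases A B
  ... | inj₁ refl = trans (cong (A ⊕_) (⊕-idem A)) (⊕-idem A)
  ... | inj₂ s    = isSum⇒⊕≡ (isSum-rotate (isSum-comm s))

  ⊕-cancel-outer : ∀ A B → B ⊕ (A ⊕ B) ≡ A
  ⊕-cancel-outer A B = trans (cong (B ⊕_) (⊕-comm A B)) (⊕-cancelˡ B A)

  ⊕-cancelʳ : ∀ A B → (A ⊕ B) ⊕ B ≡ A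
  ⊕-cancelʳ A B = trans (⊕-comm (A ⊕ B) B) (⊕-cancel-outer A B)

  ⊕-injectiveʳ : ∀ A → A ⊕ B ≡ A ⊕ C → B ≡ C
  ⊕-injectiveʳ {B} {C} A eq = trans (sym (⊕-cancelˡ A B)) (trans (cong (A ⊕_) eq) (⊕-cancelˡ A C))

  ⊕-≢ˡ : A ≢ B → A ⊕ B ≢ A
  ⊕-≢ˡ A≢B = proj₁ (proj₂ (⊕-isSum A≢B))

  ⊕-≢ʳ : A ≢ B → A ⊕ B ≢ B
  ⊕-≢ʳ A≢B = proj₁ (proj₂ (proj₂ (⊕-isSum A≢B)))

  ≢-⊕-transpose : P ≢ X ⊕ Y → X ≢ P ⊕ Y
  ≢-⊕-transpose {P} {X} {Y} P≢X⊕Y X≡P⊕Y =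
    P≢X⊕Y (trans (sym (⊕-cancelʳ P Y)) (cong (_⊕ Y) (sym X≡P⊕Y)))

  ordered-pair-induction : (R : Point → Point → Set) →
    (∀ {X Y} → X ≢ Y → R X Y → R Y X) → (∀ {X Y} → X ≢ Y → R X Y → R Y (X ⊕ Y)) →
    A ≢ B → A ∈ line i → B ∈ line i → R A B →
    X ≢ Y → X ∈ line i → Y ∈ line i → R X Y
  ordered-pair-induction {A} {B} R swap rotate A≢B A∈ B∈ rAB X≢Y X∈ Y∈ =
    go X≢Y (isSum-line-members A⊕B-isSum A∈ B∈ X∈) (isSum-line-members A⊕B-isSum A∈ B∈ Y∈)
    where
    A⊕B-isSum : IsSum A B (A ⊕ B)
    A⊕B-isSum = ⊕-isSum A≢B
    rBC : R B (A ⊕ B)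
    rBC = rotate A≢B rAB
    B≢A⊕B : B ≢ A ⊕ B
    B≢A⊕B = ≢-sym (⊕-≢ʳ A≢B)
    rCA : R (A ⊕ B) A
    rCA = subst (R (A ⊕ B)) (⊕-cancel-outer A B) (rotate B≢A⊕B rBC)
    go : ∀ {X Y} → X ≢ Y → X ≡ A ⊎ X ≡ B ⊎ X ≡ A ⊕ B → Y ≡ A ⊎ Y ≡ B ⊎ Y ≡ A ⊕ B → R X Y
    go _ (inj₁ refl)        (inj₂ (inj₁ refl)) = rAB
    go _ (inj₂ (inj₁ refl)) (inj₁ refl)        = swap A≢B rAB
    go _ (inj₂ (inj₁ refl)) (inj₂ (inj₂ refl)) = rBC
    go _ (inj₂ (inj₂ refl)) (inj₂ (inj₁ refl)) = swap B≢A⊕B rBC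
    go _ (inj₂ (inj₂ refl)) (inj₁ refl)        = rCA
    go _ (inj₁ refl)        (inj₂ (inj₂ refl)) = swap (⊕-≢ˡ A≢B) rCA
    go X≢X (inj₁ refl)        (inj₁ refl)        = contradiction refl X≢X
    go X≢X (inj₂ (inj₁ refl)) (inj₂ (inj₁ refl)) = contradiction refl X≢X
    go X≢X (inj₂ (inj₂ refl)) (inj₂ (inj₂ refl)) = contradiction refl X≢X

  record Frame (P U V : Point) : Set where
    field
      P≢U   : P ≢ U
      V≢P   : V ≢ P
      V≢U   : V ≢ U
      V≢P⊕U : V ≢ P ⊕ U

    P≢V : P ≢ V
    P≢V = ≢-sym V≢P

    U≢V : U ≢ V
    U≢V = ≢-sym V≢U

    P≢U⊕V : P ≢ U ⊕ V
    P≢U⊕V = subst (P ≢_) (⊕-comm V U) (≢-⊕-transpose V≢P⊕U)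

    U≢P⊕V : U ≢ P ⊕ V
    U≢P⊕V = ≢-⊕-transpose P≢U⊕V

    U≢U⊕V : U ≢ U ⊕ V
    U≢U⊕V = ≢-sym (⊕-≢ˡ U≢V)

    V≢U⊕V : V ≢ U ⊕ V
    V≢U⊕V = ≢-sym (⊕-≢ʳ U≢V)

    U≢P⊕[U⊕V] : U ≢ P ⊕ (U ⊕ V)
    U≢P⊕[U⊕V] = ≢-⊕-transpose (subst (P ≢_) (sym (⊕-cancelˡ U V)) P≢V)

    V≢P⊕[U⊕V] : V ≢ P ⊕ (U ⊕ V)
    V≢P⊕[U⊕V] = ≢-⊕-transpose (subst (P ≢_) (sym (⊕-cancel-outer U V)) P≢U)

    U⊕V≢P⊕U : U ⊕ V ≢ P ⊕ U
    U⊕V≢P⊕U = ≢-⊕-transpose (subst (P ≢_) (sym (trans (⊕-comm (U ⊕ V) U) (⊕-cancelˡ U V))) P≢V)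

    U⊕V≢P⊕V : U ⊕ V ≢ P ⊕ V
    U⊕V≢P⊕V = ≢-⊕-transpose (subst (P ≢_) (sym (⊕-cancelʳ U V)) P≢U)

  frame-swap : Frame P U V → Frame P V U
  frame-swap fr = record { P≢U = P≢V ; V≢P = ≢-sym P≢U ; V≢U = U≢V ; V≢P⊕U = U≢P⊕V }
    where open Frame fr

  frame-third : Frame P U V → Frame P U (U ⊕ V)
  frame-third fr = record { P≢U = P≢U ; V≢P = ≢-sym P≢U⊕V ; V≢U = ⊕-≢ˡ U≢V ; V≢P⊕U = U⊕V≢P⊕U }
    where open Frame fr

  frame-rotate : Frame P U V → Frame P V (U ⊕ V)
  frame-rotate {P} {U} {V} fr = subst (Frame P V) (⊕-comm V U) (frame-third (frame-swap fr))

  -- In the coordinates of PG(2, 𝔽₂) with basis P, U, V these are the seven nonzero vectors.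
  data Spanned (P U V : Point) : Point → Set where
    at-P     : Spanned P U V P
    at-U     : Spanned P U V U
    at-V     : Spanned P U V V
    at-U⊕V   : Spanned P U V (U ⊕ V)
    at-P⊕U   : Spanned P U V (P ⊕ U)
    at-P⊕V   : Spanned P U V (P ⊕ V)
    at-P⊕U⊕V : Spanned P U V (P ⊕ (U ⊕ V))

  span : Point → Point → Point → List Point
  span P U V = P ∷ U ∷ V ∷ U ⊕ V ∷ P ⊕ U ∷ P ⊕ V ∷ P ⊕ (U ⊕ V) ∷ []

  span-unique : Frame P U V → Unique (span P U V)
  span-unique {P} fr =
    (P≢U ∷ P≢V ∷ P≢U⊕V ∷ P≢P⊕ P≢U ∷ P≢P⊕ P≢V ∷ P≢P⊕ P≢U⊕V ∷ []) ∷
    (U≢V ∷ U≢U⊕V ∷ X≢P⊕X P≢U ∷ U≢P⊕V ∷ U≢P⊕[U⊕V] ∷ []) ∷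
    (V≢U⊕V ∷ V≢P⊕U ∷ X≢P⊕X P≢V ∷ V≢P⊕[U⊕V] ∷ []) ∷
    (U⊕V≢P⊕U ∷ U⊕V≢P⊕V ∷ X≢P⊕X P≢U⊕V ∷ []) ∷
    (P⊕-injective U≢V ∷ P⊕-injective U≢U⊕V ∷ []) ∷
    (P⊕-injective V≢U⊕V ∷ []) ∷
    [] ∷ []
    where
    open Frame fr
    P≢P⊕ : P ≢ X → P ≢ P ⊕ X
    P≢P⊕ P≢X = ≢-sym (⊕-≢ˡ P≢X)
    X≢P⊕X : P ≢ X → X ≢ P ⊕ X
    X≢P⊕X P≢X = ≢-sym (⊕-≢ʳ P≢X)
    P⊕-injective : X ≢ Y → P ⊕ X ≢ P ⊕ Y
    P⊕-injective X≢Y = X≢Y ∘ ⊕-injectiveʳ P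

  -- Pigeonhole: span P U V lists seven distinct points.
  frame-spans : Frame P U V → ∀ Z → Spanned P U V Z
  frame-spans {P} {U} {V} fr Z with any? (Z ≟_) (span P U V)
  ... | yes (here refl)                                                 = at-P
  ... | yes (there (here refl))                                         = at-U
  ... | yes (there (there (here refl)))                                 = at-V
  ... | yes (there (there (there (here refl))))                         = at-U⊕V
  ... | yes (there (there (there (there (here refl)))))                 = at-P⊕U
  ... | yes (there (there (there (there (there (here refl))))))         = at-P⊕V
  ... | yes (there (there (there (there (there (there (here refl))))))) = at-P⊕U⊕V
  ... | no Z∉span =
    contradiction (unique⇒length≤ (¬Any⇒All¬ _ Z∉span ∷ span-unique fr)) (ℕₚ.<-irrefl refl)

  ⊕-exchange : Frame P U V → U ⊕ (P ⊕ V) ≡ P ⊕ (U ⊕ V)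
  ⊕-exchange {P} {U} {V} fr = locate (frame-spans fr (U ⊕ (P ⊕ V))) (sym (⊕-cancelˡ U (P ⊕ V)))
    where
    open Frame fr
    locate : Spanned P U V Z → P ⊕ V ≡ U ⊕ Z → Z ≡ P ⊕ (U ⊕ V)
    locate at-P     eq = contradiction (⊕-injectiveʳ P (trans eq (⊕-comm U P))) V≢U
    locate at-U     eq = contradiction (sym (trans eq (⊕-idem U))) U≢P⊕V
    locate at-V     eq = contradiction (sym eq) U⊕V≢P⊕V
    locate at-U⊕V   eq = contradiction (trans eq (⊕-cancelˡ U V)) (⊕-≢ʳ P≢V)
    locate at-P⊕U   eq = contradiction (trans eq (⊕-cancel-outer P U)) (⊕-≢ˡ P≢V)
    locate at-P⊕V   eq = contradiction (sym eq) (⊕-≢ʳ U≢P⊕V)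
    locate at-P⊕U⊕V _  = refl

  frame-pivot : Frame P U V → P ≢ X → Frame P U X ⊎ Frame P V X
  frame-pivot {P} {U} {V} {X} fr P≢X with X ≟ U | X ≟ P ⊕ U
  ... | yes refl | _        = inj₂ (frame-swap fr)
  ... | no X≢U   | no X≢P⊕U =
    inj₁ (record { P≢U = Frame.P≢U fr ; V≢P = ≢-sym P≢X ; V≢U = X≢U ; V≢P⊕U = X≢P⊕U })
  ... | no _     | yes refl =
    inj₂ (record { P≢U = Frame.P≢V fr ; V≢P = ≢-sym P≢X ; V≢U = ≢-sym (Frame.V≢P⊕U fr)
                 ; V≢P⊕U = Frame.U≢V fr ∘ ⊕-injectiveʳ P })

  frame-point-off-line : Frame P U V → P ≢ Q → ∃ λ X → X ≢ P × X ≢ Q × X ≢ P ⊕ Q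
  frame-point-off-line {P} {U} {V} {Q} fr P≢Q with U ≟ Q | U ≟ P ⊕ Q | V ≟ Q | V ≟ P ⊕ Q
  ... | no U≢Q   | no U≢P⊕Q | _        | _        = U , ≢-sym (Frame.P≢U fr) , U≢Q , U≢P⊕Q
  ... | _        | _        | no V≢Q   | no V≢P⊕Q = V , Frame.V≢P fr , V≢Q , V≢P⊕Q
  ... | yes refl | _        | yes V≡U  | _        = contradiction V≡U (Frame.V≢U fr)
  ... | yes refl | _        | no _     | yes refl = contradiction (sym (⊕-cancel-outer P U)) (Frame.P≢U⊕V fr)
  ... | no _     | yes refl | yes refl | _        = contradiction (sym (⊕-cancelʳ P V)) (Frame.P≢U⊕V fr)
  ... | no _     | yes U≡   | no _     | yes V≡   = contradiction (trans V≡ (sym U≡)) (Frame.V≢U fr)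

  frame-pair : Frame P U V → P ≢ Q → ∃ λ X → Frame P X (P ⊕ Q) × Frame Q X (P ⊕ Q)
  frame-pair {P} {Q = Q} fr P≢Q with frame-point-off-line fr P≢Q
  ... | X , X≢P , X≢Q , X≢P⊕Q =
    X , record { P≢U = ≢-sym X≢P ; V≢P = ⊕-≢ˡ P≢Q ; V≢U = ≢-sym X≢P⊕Q
               ; V≢P⊕U = λ eq → X≢Q (sym (⊕-injectiveʳ P eq)) }
      , record { P≢U = ≢-sym X≢Q ; V≢P = ⊕-≢ʳ P≢Q ; V≢U = ≢-sym X≢P⊕Q
               ; V≢P⊕U = λ eq → X≢P (sym (⊕-injectiveʳ Q (trans (⊕-comm Q P) eq))) }

  record Quadrangle (A B C D : Point) : Set where
    field
      C≢D     : C ≢ D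
      A≢C     : A ≢ C
      A≢D     : A ≢ D
      B≢C     : B ≢ C
      B≢D     : B ≢ D
      A⊕C≡B⊕D : A ⊕ C ≡ B ⊕ D
      A⊕D≡B⊕C : A ⊕ D ≡ B ⊕ C

    A≢B : A ≢ B
    A≢B refl = C≢D (⊕-injectiveʳ A A⊕C≡B⊕D)

  frame-quadrangle : Frame P U V → Quadrangle P (P ⊕ (U ⊕ V)) U V
  frame-quadrangle {P} {U} {V} fr = record
    { C≢D = U≢V ; A≢C = P≢U ; A≢D = P≢V
    ; B≢C = ≢-sym U≢P⊕[U⊕V] ; B≢D = ≢-sym V≢P⊕[U⊕V]
    ; A⊕C≡B⊕D = sym (trans (⊕-comm _ V) (trans (⊕-exchange (frame-rotate fr)) (cong (P ⊕_) (⊕-cancel-outer U V))))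
    ; A⊕D≡B⊕C = sym (trans (⊕-comm _ U) (trans (⊕-exchange (frame-third fr)) (cong (P ⊕_) (⊕-cancelˡ U V))))
    }
    where open Frame fr

  another-point : ∀ P → A ≢ B → A ∈ line i → B ∈ line i → ∃ λ X → X ∈ line i × P ≢ X
  another-point {A = A} P A≢B A∈ B∈ with P ≟ A
  ... | yes refl = _ , B∈ , A≢B
  ... | no P≢A   = A , A∈ , P≢A

  frame-through : i ≢ j → P ∈ line i → P ∈ line j → U ∈ line i → V ∈ line j → P ≢ U → P ≢ V →
                  Frame P U V
  frame-through i≢j P∈i P∈j U∈i V∈j P≢U P≢V = record
    { P≢U = P≢U ; V≢P = ≢-sym P≢V
    ; V≢U = λ { refl → i≢j (line-unique P≢V P∈i U∈i P∈j V∈j) }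
    ; V≢P⊕U = λ { refl → i≢j (line-unique P≢V P∈i (isSum-onLine (⊕-isSum P≢U) P∈i U∈i) P∈j V∈j) }
    }

  frame-third-line : Frame P U V → i ≢ k → j ≢ k →
                     U ∈ line i → V ∈ line j → P ∈ line i → P ∈ line j → P ∈ line k →
                     X ∈ line k → P ≢ X → U ⊕ V ∈ line k
  frame-third-line {P = P} {U = U} {V = V} {i = i} {k = k} {j = j} {X = X} fr i≢k j≢k U∈i V∈j P∈i P∈j P∈k X∈k P≢X =
    locate (frame-spans fr X) X∈k P≢X
    where
    open Frame fr
    onLine⊕ : P ≢ Y → P ∈ line l → Y ∈ line l → P ⊕ Y ∈ line l
    onLine⊕ P≢Y P∈ Y∈ = isSum-onLine (⊕-isSum P≢Y) P∈ Y∈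
    locate : Spanned P U V Z → Z ∈ line k → P ≢ Z → U ⊕ V ∈ line k
    locate at-P     _   P≢P = contradiction refl P≢P
    locate at-U     U∈k _   = contradiction (line-unique P≢U P∈i U∈i P∈k U∈k) i≢k
    locate at-V     V∈k _   = contradiction (line-unique P≢V P∈j V∈j P∈k V∈k) j≢k
    locate at-U⊕V   W∈k _   = W∈k
    locate at-P⊕U   Y∈k P≢Y = contradiction (line-unique P≢Y P∈i (onLine⊕ P≢U P∈i U∈i) P∈k Y∈k) i≢k
    locate at-P⊕V   Y∈k P≢Y = contradiction (line-unique P≢Y P∈j (onLine⊕ P≢V P∈j V∈j) P∈k Y∈k) j≢k
    locate at-P⊕U⊕V Y∈k P≢Y = subst (_∈ line k) (⊕-cancelˡ P (U ⊕ V)) (onLine⊕ P≢Y P∈k Y∈k)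

module Automorphism {Π : FanoPlane} (α : Aut Π) where
  open FanoPlane Π using (IsSum)
  open FanoGeometry Π
  open Aut α

  private variable
    A B C P U V : Point

  g-injective : g A ≡ g B → A ≡ B
  g-injective {A} {B} gA≡gB = trans (sym (g⁻¹∘g A)) (trans (cong g⁻¹ gA≡gB) (g⁻¹∘g B))

  g-isSum : IsSum A B C → IsSum (g A) (g B) (g C)
  g-isSum (A≢B , C≢A , C≢B , i , A∈ , B∈ , C∈) with line→line i
  ... | j , image =
    A≢B ∘ g-injective , C≢A ∘ g-injective , C≢B ∘ g-injective , j ,
    proj₂ (image _) (_ , A∈ , refl) , proj₂ (image _) (_ , B∈ , refl) , proj₂ (image _) (_ , C∈ , refl)

  g-⊕ : ∀ A B → g (A ⊕ B) ≡ g A ⊕ g B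
  g-⊕ A B with ⊕-cases A B
  ... | inj₁ refl = trans (cong g (⊕-idem A)) (sym (⊕-idem (g A)))
  ... | inj₂ s    = sym (isSum⇒⊕≡ (g-isSum s))

  g-frame : Frame P U V → Frame (g P) (g U) (g V)
  g-frame {P} {U} fr = record
    { P≢U = P≢U ∘ g-injective ; V≢P = V≢P ∘ g-injective ; V≢U = V≢U ∘ g-injective
    ; V≢P⊕U = λ eq → V≢P⊕U (g-injective (trans eq (sym (g-⊕ P U)))) }
    where open Frame fr

module _ where
  open import Data.Sign.Properties
    using (s*s≡+; opposite[s]*s≡-; opposite-selfInverse; opposite-involutive; *-comm; *-assoc)
  open import Algebra.Properties.CommutativeSemigroup Data.Sign.Properties.*-commutativeSemigroup
    using (interchange; xy∙z≈yz∙x; xy∙z≈xz∙y)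
  open import Data.Sign using (_*_; -; +)
  open ≡-Reasoning

  sign-dichotomy : ∀ s t → t ≡ s ⊎ t ≡ opposite s
  sign-dichotomy + + = inj₁ refl
  sign-dichotomy + - = inj₂ refl
  sign-dichotomy - + = inj₂ refl
  sign-dichotomy - - = inj₁ refl

  opposite-*-opposite : ∀ s t → opposite s * opposite t ≡ s * t
  opposite-*-opposite + + = refl
  opposite-*-opposite + - = refl
  opposite-*-opposite - + = refl
  opposite-*-opposite - - = refl

  *≡-⇒≡opposite : ∀ {s t} → s * t ≡ - → s ≡ opposite t
  *≡-⇒≡opposite {s = +} {t = - } _ = refl
  *≡-⇒≡opposite {s = - } {t = +} _ = refl
  *≡-⇒≡opposite {s = +} {t = +} ()
  *≡-⇒≡opposite {s = - } {t = - } ()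

  sign-shuffle : ∀ x y z w → x * y ≡ opposite (z * w) → x * z ≡ opposite (w * y)
  sign-shuffle x y z w xy≡-zw = *≡-⇒≡opposite (begin
    x * z * (w * y)             ≡⟨ cong (x * z *_) (*-comm w y) ⟩
    x * z * (y * w)             ≡⟨ interchange x z y w ⟩
    x * y * (z * w)             ≡⟨ cong (_* (z * w)) xy≡-zw ⟩
    opposite (z * w) * (z * w)  ≡⟨ opposite[s]*s≡- (z * w) ⟩
    -                           ∎)

  equal-products⇒interleaved≡+ : ∀ a b c a′ b′ c′ → a * b * c ≡ a′ * b′ * c′ →
                                 a * a′ * (b * b′) * (c * c′) ≡ +
  equal-products⇒interleaved≡+ a b c a′ b′ c′ eq = begin
    a * a′ * (b * b′) * (c * c′)           ≡⟨ cong (_* (c * c′)) (interchange a a′ b b′) ⟩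
    a * b * (a′ * b′) * (c * c′)           ≡⟨ interchange (a * b) (a′ * b′) c c′ ⟩
    a * b * c * (a′ * b′ * c′)             ≡⟨ cong (a * b * c *_) (sym eq) ⟩
    a * b * c * (a * b * c)                ≡⟨ s*s≡+ (a * b * c) ⟩
    +                                      ∎

  module _ (Π : FanoPlane) (ε : Point → Point → Sign) where
    open FanoPlane Π using (IsSum)
    open FanoGeometry Π using (Quadrangle; isSum-rotate)

    RotationRule : Set
    RotationRule = ∀ {A B C} → IsSum A B C → ε B C ≡ ε A B

    QuadrangleRule : Set
    QuadrangleRule = ∀ {A B C D} → Quadrangle A B C D → ε A C * ε B D ≡ opposite (ε A D * ε B C)

    antisym⇒rotationRule : IsMultiplicationFactor ε →
                           (∀ {A B C} → IsSum A B C → ε B C ≡ opposite (ε A C)) → RotationRule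
    antisym⇒rotationRule ε-antisym isSum-opposite {A} {B} {C} s@(A≢B , C≢A , _) = begin
      ε B C                        ≡⟨ isSum-opposite s ⟩
      opposite (ε A C)             ≡⟨ cong opposite (ε-antisym C A C≢A) ⟩
      opposite (opposite (ε C A))  ≡⟨ opposite-involutive (ε C A) ⟩
      ε C A                        ≡⟨ isSum-opposite (isSum-rotate s) ⟩
      opposite (ε B A)             ≡⟨ cong opposite (ε-antisym A B A≢B) ⟩
      opposite (opposite (ε A B))  ≡⟨ opposite-involutive (ε A B) ⟩
      ε A B                        ∎

  module FrameSign (Π : FanoPlane) (ε : Point → Point → Sign)
    (ε-antisym : IsMultiplicationFactor ε)
    (ε-rotate : RotationRule Π ε) (ε-quadrangle : QuadrangleRule Π ε) where
    open FanoPlane Π using (IsSum)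
    open FanoGeometry Π

    private variable
      A B P Q U V X Z : Point

    ε-⊕ʳ-opposite : Q ≢ X → ε Q (Q ⊕ X) ≡ opposite (ε Q X)
    ε-⊕ʳ-opposite {Q} {X} Q≢X = sym (opposite-selfInverse (sym (begin
      ε Q X                   ≡⟨ ε-rotate (isSum-rotate (isSum-rotate (⊕-isSum Q≢X))) ⟩
      ε (Q ⊕ X) Q             ≡⟨ ε-antisym Q (Q ⊕ X) (≢-sym (⊕-≢ˡ Q≢X)) ⟩
      opposite (ε Q (Q ⊕ X))  ∎)))

    frameSign : Point → Point → Point → Sign
    frameSign Q U V = ε Q U * ε Q V * ε Q (U ⊕ V)

    frameSign-swap : frameSign Q U V ≡ frameSign Q V U
    frameSign-swap {Q} {U} {V} = cong₂ _*_ (*-comm (ε Q U) (ε Q V)) (cong (ε Q) (⊕-comm U V))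

    frameSign-rotate : frameSign Q U V ≡ frameSign Q V (U ⊕ V)
    frameSign-rotate {Q} {U} {V} =
      trans (xy∙z≈yz∙x (ε Q U) (ε Q V) (ε Q (U ⊕ V))) (cong (λ Y → ε Q V * ε Q (U ⊕ V) * ε Q Y) (sym (⊕-cancel-outer U V)))

    frameSign-third : frameSign Q U V ≡ frameSign Q U (U ⊕ V)
    frameSign-third {Q} {U} {V} =
      trans (xy∙z≈xz∙y (ε Q U) (ε Q V) (ε Q (U ⊕ V))) (cong (λ Y → ε Q U * ε Q (U ⊕ V) * ε Q Y) (sym (⊕-cancelˡ U V)))

    frameSign-translate : Frame Q U V → frameSign Q U (Q ⊕ V) ≡ frameSign Q U V
    frameSign-translate {Q} {U} {V} fr = begin
      ε Q U * ε Q (Q ⊕ V) * ε Q (U ⊕ (Q ⊕ V))         ≡⟨ cong (λ Y → ε Q U * ε Q (Q ⊕ V) * ε Q Y) (⊕-exchange fr) ⟩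
      ε Q U * ε Q (Q ⊕ V) * ε Q (Q ⊕ (U ⊕ V))         ≡⟨ cong₂ (λ s t → ε Q U * s * t) (ε-⊕ʳ-opposite P≢V) (ε-⊕ʳ-opposite P≢U⊕V) ⟩
      ε Q U * opposite (ε Q V) * opposite (ε Q (U ⊕ V)) ≡⟨ *-assoc (ε Q U) _ _ ⟩
      ε Q U * (opposite (ε Q V) * opposite (ε Q (U ⊕ V))) ≡⟨ cong (ε Q U *_) (opposite-*-opposite (ε Q V) (ε Q (U ⊕ V))) ⟩
      ε Q U * (ε Q V * ε Q (U ⊕ V))                   ≡⟨ *-assoc (ε Q U) _ _ ⟨
      frameSign Q U V                                   ∎
      where open Frame fr

    frameSign-moveBase : Frame P U V → frameSign P U V ≡ frameSign (P ⊕ (U ⊕ V)) U V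
    frameSign-moveBase {P} {U} {V} fr = begin
      ε P U * ε P V * ε P W                        ≡⟨ cong₂ _*_ (sign-shuffle (ε P U) (ε Y V) (ε P V) (ε Y U) (ε-quadrangle (frame-quadrangle fr)))
                                                                  ε[P,W]≡-ε[Y,W] ⟩
      opposite (ε Y U * ε Y V) * opposite (ε Y W)  ≡⟨ opposite-*-opposite (ε Y U * ε Y V) (ε Y W) ⟩
      ε Y U * ε Y V * ε Y W                        ∎
      where
      open Frame fr
      W Y : Point
      W = U ⊕ V
      Y = P ⊕ W
      ε[P,W]≡-ε[Y,W] : ε P W ≡ opposite (ε Y W)
      ε[P,W]≡-ε[Y,W] = trans (sym (ε-rotate (⊕-isSum P≢U⊕V)))
                             (sym (opposite-selfInverse (sym (ε-antisym W Y (≢-sym (⊕-≢ʳ P≢U⊕V))))))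

    frameSign-moveBase-first : Frame P U V → frameSign P U V ≡ frameSign (P ⊕ U) U V
    frameSign-moveBase-first {P} {U} {V} fr = begin
      frameSign P U V                          ≡⟨ frameSign-rotate ⟩
      frameSign P V (U ⊕ V)                    ≡⟨ frameSign-moveBase (frame-rotate fr) ⟩
      frameSign (P ⊕ (V ⊕ (U ⊕ V))) V (U ⊕ V)  ≡⟨ cong (λ Y → frameSign (P ⊕ Y) V (U ⊕ V)) (⊕-cancel-outer U V) ⟩
      frameSign (P ⊕ U) V (U ⊕ V)              ≡⟨ frameSign-rotate ⟨
      frameSign (P ⊕ U) U V                    ∎

    frameSign-vary-second : Frame P U V → Frame P U X → frameSign P U V ≡ frameSign P U X
    frameSign-vary-second {P} {U} {V} {X} fr = locate (frame-spans fr X)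
      where
      locate : Spanned P U V Z → Frame P U Z → frameSign P U V ≡ frameSign P U Z
      locate at-P     frZ = contradiction refl (Frame.V≢P frZ)
      locate at-U     frZ = contradiction refl (Frame.V≢U frZ)
      locate at-V     _   = refl
      locate at-U⊕V   _   = frameSign-third
      locate at-P⊕U   frZ = contradiction refl (Frame.V≢P⊕U frZ)
      locate at-P⊕V   _   = sym (frameSign-translate fr)
      locate at-P⊕U⊕V _   = trans frameSign-third (sym (frameSign-translate (frame-third fr)))

    frameSign-via-pivot : Frame P U V → Frame P U A → Frame P A B → frameSign P U V ≡ frameSign P A B
    frameSign-via-pivot frUV frUA frAB =
      trans (frameSign-vary-second frUV frUA) (trans frameSign-swap (frameSign-vary-second (frame-swap frUA) frAB))

    frameSign-vary-pair : Frame P U V → Frame P A B → frameSign P U V ≡ frameSign P A B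
    frameSign-vary-pair fr frAB with frame-pivot fr (Frame.P≢U frAB)
    ... | inj₁ frUA = frameSign-via-pivot fr frUA frAB
    ... | inj₂ frVA = trans frameSign-swap (frameSign-via-pivot (frame-swap fr) frVA frAB)

    frameSign-vary-base : Frame P U V → Frame Q U V → frameSign P U V ≡ frameSign Q U V
    frameSign-vary-base {P} {U} {V} {Q} fr = locate (frame-spans fr Q)
      where
      locate : Spanned P U V Z → Frame Z U V → frameSign P U V ≡ frameSign Z U V
      locate at-P     _   = refl
      locate at-U     frZ = contradiction refl (Frame.P≢U frZ)
      locate at-V     frZ = contradiction refl (Frame.P≢V frZ)
      locate at-U⊕V   frZ = contradiction refl (Frame.P≢U⊕V frZ)
      locate at-P⊕U   _   = frameSign-moveBase-first fr
      locate at-P⊕V   _   = trans frameSign-swap (trans (frameSign-moveBase-first (frame-swap fr)) frameSign-swap)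
      locate at-P⊕U⊕V _   = frameSign-moveBase fr

    frameSign-constant : Frame P U V → Frame Q A B → frameSign P U V ≡ frameSign Q A B
    frameSign-constant {P} {Q = Q} fr frAB with P ≟ Q
    ... | yes refl = frameSign-vary-pair fr frAB
    ... | no P≢Q with frame-pair fr P≢Q
    ... | _ , frP , frQ =
      trans (frameSign-vary-pair fr frP) (trans (frameSign-vary-base frP frQ) (frameSign-vary-pair frQ frAB))

  module DeltaStar {Π : FanoPlane} (ε : Point → Point → Sign) (ε-antisym : IsMultiplicationFactor ε)
    (ε-rotate : RotationRule Π ε) (ε-quadrangle : QuadrangleRule Π ε) (α : Aut Π) where
    open FanoPlane Π using (line)
    open FanoGeometry Π
    open Aut α using (g)
    open Automorphism α
    open FrameSign Π ε ε-antisym ε-rotate ε-quadrangle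

    private variable
      A B P X Y : Point
      i : Fin 7

    δ*-swap : A ≢ B → δ* ε α B A ≡ δ* ε α A B
    δ*-swap {A} {B} A≢B = trans (cong₂ _*_ (ε-antisym A B A≢B) (ε-antisym (g A) (g B) (A≢B ∘ g-injective)))
                                (opposite-*-opposite (ε A B) (ε (g A) (g B)))

    δ*-rotate : A ≢ B → δ* ε α B (A ⊕ B) ≡ δ* ε α A B
    δ*-rotate {A} {B} A≢B = cong₂ _*_ (ε-rotate (⊕-isSum A≢B))
      (trans (cong (ε (g B)) (g-⊕ A B)) (ε-rotate (⊕-isSum (A≢B ∘ g-injective))))

    δ*-line-invariant : A ≢ B → A ∈ line i → B ∈ line i →
                        ∀ {X Y} → X ≢ Y → X ∈ line i → Y ∈ line i → δ* ε α X Y ≡ δ* ε α A B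
    δ*-line-invariant {A} {B} A≢B A∈ B∈ =
      ordered-pair-induction (λ X Y → δ* ε α X Y ≡ δ* ε α A B)
        (λ X≢Y δXY≡ → trans (δ*-swap X≢Y) δXY≡) (λ X≢Y δXY≡ → trans (δ*-rotate X≢Y) δXY≡) A≢B A∈ B∈ refl

    δ*-pencil : Frame P X Y → δ* ε α P X * δ* ε α P Y * δ* ε α P (X ⊕ Y) ≡ +
    δ*-pencil {P} {X} {Y} fr = begin
      δ* ε α P X * δ* ε α P Y * (ε P (X ⊕ Y) * ε (g P) (g (X ⊕ Y)))
        ≡⟨ cong (λ Z → δ* ε α P X * δ* ε α P Y * (ε P (X ⊕ Y) * ε (g P) Z)) (g-⊕ X Y) ⟩
      δ* ε α P X * δ* ε α P Y * (ε P (X ⊕ Y) * ε (g P) (g X ⊕ g Y))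
        ≡⟨ equal-products⇒interleaved≡+ (ε P X) (ε P Y) (ε P (X ⊕ Y)) (ε (g P) (g X)) (ε (g P) (g Y))
             (ε (g P) (g X ⊕ g Y)) (frameSign-constant fr (g-frame fr)) ⟩
      +  ∎

  pencil-δ*-product : ∀ {Π : FanoPlane} {ε : Point → Point → Sign} →
    IsMultiplicationFactor ε → RotationRule Π ε → QuadrangleRule Π ε →
    (P : Point) (D₁ D₂ D₃ : Fin 7) →
    D₁ ≢ D₂ → D₁ ≢ D₃ → D₂ ≢ D₃ →
    P ∈ FanoPlane.line Π D₁ → P ∈ FanoPlane.line Π D₂ → P ∈ FanoPlane.line Π D₃ →
    (α : Aut Π) →
    (A₁ B₁ A₂ B₂ A₃ B₃ : Point) →
    A₁ ≢ B₁ → A₁ ∈ FanoPlane.line Π D₁ → B₁ ∈ FanoPlane.line Π D₁ →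
    A₂ ≢ B₂ → A₂ ∈ FanoPlane.line Π D₂ → B₂ ∈ FanoPlane.line Π D₂ →
    A₃ ≢ B₃ → A₃ ∈ FanoPlane.line Π D₃ → B₃ ∈ FanoPlane.line Π D₃ →
    δ* ε α A₁ B₁ * δ* ε α A₂ B₂ * δ* ε α A₃ B₃ ≡ +
  pencil-δ*-product {Π} {ε} ε-antisym ε-rotate ε-quadrangle P D₁ D₂ D₃ D₁≢D₂ D₁≢D₃ D₂≢D₃ P∈D₁ P∈D₂ P∈D₃ α
    A₁ B₁ A₂ B₂ A₃ B₃ A₁≢B₁ A₁∈D₁ B₁∈D₁ A₂≢B₂ A₂∈D₂ B₂∈D₂ A₃≢B₃ A₃∈D₃ B₃∈D₃
    with FanoGeometry.another-point Π P A₁≢B₁ A₁∈D₁ B₁∈D₁ | FanoGeometry.another-point Π P A₂≢B₂ A₂∈D₂ B₂∈D₂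
       | FanoGeometry.another-point Π P A₃≢B₃ A₃∈D₃ B₃∈D₃
  ... | X₁ , X₁∈D₁ , P≢X₁ | X₂ , X₂∈D₂ , P≢X₂ | X₃ , X₃∈D₃ , P≢X₃ = begin
    δ* ε α A₁ B₁ * δ* ε α A₂ B₂ * δ* ε α A₃ B₃
      ≡⟨ cong₂ _*_ (cong₂ _*_ (δ*-line-invariant P≢X₁ P∈D₁ X₁∈D₁ A₁≢B₁ A₁∈D₁ B₁∈D₁)
                              (δ*-line-invariant P≢X₂ P∈D₂ X₂∈D₂ A₂≢B₂ A₂∈D₂ B₂∈D₂))
                   (δ*-line-invariant (Frame.P≢U⊕V frame) P∈D₃ X₁⊕X₂∈D₃ A₃≢B₃ A₃∈D₃ B₃∈D₃) ⟩
    δ* ε α P X₁ * δ* ε α P X₂ * δ* ε α P (X₁ ⊕ X₂)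
      ≡⟨ δ*-pencil frame ⟩
    +  ∎
    where
    open FanoGeometry Π
    open DeltaStar ε ε-antisym ε-rotate ε-quadrangle α
    frame : Frame P X₁ X₂
    frame = frame-through D₁≢D₂ P∈D₁ P∈D₂ X₁∈D₁ X₂∈D₂ P≢X₁ P≢X₂
    X₁⊕X₂∈D₃ : X₁ ⊕ X₂ ∈ FanoPlane.line Π D₃
    X₁⊕X₂∈D₃ = frame-third-line frame D₁≢D₃ D₂≢D₃ X₁∈D₁ X₂∈D₂ P∈D₁ P∈D₂ P∈D₃ X₃∈D₃ P≢X₃

module CompositionFactor {c ℓ} (𝔽 : Field c ℓ) (char≢2 : CharNot2 𝔽)
  (Π : FanoPlane) (ε : Point → Point → Sign) where
  open Field 𝔽 hiding (zero; refl; sym; trans)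
  open Field 𝔽 using () renaming (refl to ≈-refl; sym to ≈-sym; trans to ≈-trans)
  open import Relation.Binary.Reasoning.Setoid setoid
  open import Algebra.Properties.Ring ring using (x+x≈x⇒x≈0; -‿distribˡ-*; -‿distribʳ-*)
  open import Algebra.Properties.AbelianGroup +-abelianGroup using (⁻¹-∙-comm; ⁻¹-involutive)
  open import Data.Sign.Properties using (s*s≡+; s*opposite[s]≡-)
  open Oct
  open FanoPlane Π using (IsSum; isSum?)
  open FanoGeometry Π

  private variable
    A B R U V : Point

  two : Carrier
  two = 1# + 1#

  sF : Sign → Carrier
  sF = signF 𝔽

  square≉0 : ∀ {x} → x ≉ 0# → x * x ≉ 0#
  square≉0 {x} x≉0 xx≈0 with inverse x x≉0
  ... | y , xy≈1 = x≉0 (begin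
    x            ≈⟨ *-identityʳ x ⟨
    x * 1#       ≈⟨ *-congˡ xy≈1 ⟨
    x * (x * y)  ≈⟨ *-assoc x x y ⟨
    x * x * y    ≈⟨ *-congʳ xx≈0 ⟩
    0# * y       ≈⟨ zeroˡ y ⟩
    0#           ∎)

  -x*-x≈x*x : ∀ x → (- x) * (- x) ≈ x * x
  -x*-x≈x*x x = begin
    (- x) * (- x)  ≈⟨ -‿distribˡ-* x (- x) ⟨
    - (x * - x)    ≈⟨ -‿cong (-‿distribʳ-* x x) ⟨
    - (- (x * x))  ≈⟨ ⁻¹-involutive (x * x) ⟩
    x * x          ∎

  sF-same-sum-square : ∀ s → (sF s + sF s) * (sF s + sF s) ≈ two * two
  sF-same-sum-square Sign.+ = ≈-refl
  sF-same-sum-square Sign.- = ≈-trans (*-cong (⁻¹-∙-comm 1# 1#) (⁻¹-∙-comm 1# 1#)) (-x*-x≈x*x two)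

  sF-opposite-sum-square : ∀ s → (sF s + sF (opposite s)) * (sF s + sF (opposite s)) ≈ 0#
  sF-opposite-sum-square Sign.+ = ≈-trans (*-congʳ (-‿inverseʳ 1#)) (zeroˡ _)
  sF-opposite-sum-square Sign.- = ≈-trans (*-congʳ (-‿inverseˡ 1#)) (zeroˡ _)

  -- Each square (sF s + sF t)² is 4 or 0, so a sum of two of them equals 4 exactly when one pair agrees
  -- and the other does not.
  signs-from-norm : ∀ a b c d →
    (sF a + sF b) * (sF a + sF b) + (sF c + sF d) * (sF c + sF d) ≈ two * two →
    a Sign.* b ≡ opposite (c Sign.* d)
  signs-from-norm a b c d = from-dichotomies (sign-dichotomy a b) (sign-dichotomy c d)
    where
    NormIs4 : Sign → Sign → Set ℓ
    NormIs4 b d = (sF a + sF b) * (sF a + sF b) + (sF c + sF d) * (sF c + sF d) ≈ two * two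
    from-dichotomies : ∀ {b d} → b ≡ a ⊎ b ≡ opposite a → d ≡ c ⊎ d ≡ opposite c →
                       NormIs4 b d → a Sign.* b ≡ opposite (c Sign.* d)
    from-dichotomies (inj₁ refl) (inj₂ refl) _ = trans (s*s≡+ a) (sym (cong opposite (s*opposite[s]≡- c)))
    from-dichotomies (inj₂ refl) (inj₁ refl) _ = trans (s*opposite[s]≡- a) (sym (cong opposite (s*s≡+ c)))
    from-dichotomies (inj₁ refl) (inj₁ refl) norm≈4 = contradiction (x+x≈x⇒x≈0 (two * two) (begin
      two * two + two * two  ≈⟨ +-cong (sF-same-sum-square a) (sF-same-sum-square c) ⟨
      _                      ≈⟨ norm≈4 ⟩
      two * two              ∎)) (square≉0 char≢2)
    from-dichotomies (inj₂ refl) (inj₂ refl) norm≈4 = contradiction (begin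
      two * two              ≈⟨ norm≈4 ⟨
      _                      ≈⟨ +-cong (sF-opposite-sum-square a) (sF-opposite-sum-square c) ⟩
      0# + 0#                ≈⟨ +-identityˡ 0# ⟩
      0#                     ∎) (square≉0 char≢2)

  sum-cong : ∀ n {f h : Fin n → Carrier} → (∀ i → f i ≈ h i) → sumFin 𝔽 n f ≈ sumFin 𝔽 n h
  sum-cong ℕ.zero    f≈h = ≈-refl
  sum-cong (ℕ.suc n) f≈h = +-cong (f≈h zero) (sum-cong n (f≈h ∘ suc))

  sum-zero : ∀ n {f : Fin n → Carrier} → (∀ i → f i ≈ 0#) → sumFin 𝔽 n f ≈ 0#
  sum-zero ℕ.zero    f≈0 = ≈-refl
  sum-zero (ℕ.suc n) f≈0 = ≈-trans (+-cong (f≈0 zero) (sum-zero n (f≈0 ∘ suc))) (+-identityˡ 0#)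

  sum-single : ∀ n (i : Fin n) {f : Fin n → Carrier} → (∀ j → j ≢ i → f j ≈ 0#) → sumFin 𝔽 n f ≈ f i
  sum-single (ℕ.suc n) zero    {f} f≈0 =
    ≈-trans (+-congˡ (sum-zero n (λ j → f≈0 (suc j) λ ()))) (+-identityʳ (f zero))
  sum-single (ℕ.suc n) (suc i) {f} f≈0 =
    ≈-trans (+-cong (f≈0 zero λ ()) (sum-single n i (λ j j≢i → f≈0 (suc j) (j≢i ∘ suc-injective))))
            (+-identityˡ (f (suc i)))

  sum-pair : ∀ n (i j : Fin n) {f : Fin n → Carrier} → i ≢ j → (∀ k → k ≢ i → k ≢ j → f k ≈ 0#) →
             sumFin 𝔽 n f ≈ f i + f j
  sum-pair (ℕ.suc n) zero    zero    i≢j _ = contradiction refl i≢j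
  sum-pair (ℕ.suc n) zero    (suc j) i≢j f≈0 =
    +-congˡ (sum-single n j (λ k k≢j → f≈0 (suc k) (λ ()) (k≢j ∘ suc-injective)))
  sum-pair (ℕ.suc n) (suc i) zero    {f} i≢j f≈0 =
    ≈-trans (+-congˡ (sum-single n i (λ k k≢i → f≈0 (suc k) (k≢i ∘ suc-injective) (λ ())))) (+-comm (f zero) _)
  sum-pair (ℕ.suc n) (suc i) (suc j) {f} i≢j f≈0 =
    ≈-trans (+-cong (f≈0 zero (λ ()) (λ ()))
                    (sum-pair n i j (i≢j ∘ cong suc) (λ k k≢i k≢j → f≈0 (suc k) (k≢i ∘ suc-injective) (k≢j ∘ suc-injective))))
            (+-identityˡ _)

  *-distribˡ-sum : ∀ n x (f : Fin n → Carrier) → x * sumFin 𝔽 n f ≈ sumFin 𝔽 n (λ i → x * f i)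
  *-distribˡ-sum ℕ.zero    x f = zeroʳ x
  *-distribˡ-sum (ℕ.suc n) x f = ≈-trans (distribˡ x (f zero) _) (+-congˡ (*-distribˡ-sum n x (f ∘ suc)))

  kronecker : ∀ {n} → Fin n → Fin n → Carrier
  kronecker zero    zero    = 1#
  kronecker zero    (suc _) = 0#
  kronecker (suc _) zero    = 0#
  kronecker (suc i) (suc j) = kronecker i j

  kronecker-refl : ∀ {n} (i : Fin n) → kronecker i i ≈ 1#
  kronecker-refl zero    = ≈-refl
  kronecker-refl (suc i) = kronecker-refl i

  kronecker-≢ : ∀ {n} {i j : Fin n} → i ≢ j → kronecker i j ≈ 0#
  kronecker-≢ {i = zero}  {zero}  i≢j = contradiction refl i≢j
  kronecker-≢ {i = zero}  {suc j} _   = ≈-refl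
  kronecker-≢ {i = suc i} {zero}  _   = ≈-refl
  kronecker-≢ {i = suc i} {suc j} i≢j = kronecker-≢ (i≢j ∘ cong suc)

  kronecker₂ : Point → Point → Point → Carrier
  kronecker₂ A B P = kronecker A P + kronecker B P

  kronecker₂-off : R ≢ A → R ≢ B → kronecker₂ A B R ≈ 0#
  kronecker₂-off R≢A R≢B = ≈-trans (+-cong (kronecker-≢ (≢-sym R≢A)) (kronecker-≢ (≢-sym R≢B))) (+-identityˡ 0#)

  kronecker₂-left : A ≢ B → kronecker₂ A B A ≈ 1#
  kronecker₂-left {A} A≢B = ≈-trans (+-cong (kronecker-refl A) (kronecker-≢ (≢-sym A≢B))) (+-identityʳ 1#)

  kronecker₂-right : A ≢ B → kronecker₂ A B B ≈ 1#
  kronecker₂-right {B = B} A≢B = ≈-trans (+-cong (kronecker-≢ A≢B) (kronecker-refl B)) (+-identityˡ 1#)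

  sum-kronecker : ∀ A (G : Point → Carrier) → sumFin 𝔽 7 (λ P → kronecker A P * G P) ≈ G A
  sum-kronecker A G = ≈-trans (sum-single 7 A (λ P P≢A → ≈-trans (*-congʳ (kronecker-≢ (≢-sym P≢A))) (zeroˡ (G P))))
                              (≈-trans (*-congʳ (kronecker-refl A)) (*-identityˡ (G A)))

  sum-kronecker₂ : A ≢ B → ∀ (G : Point → Carrier) → sumFin 𝔽 7 (λ P → kronecker₂ A B P * G P) ≈ G A + G B
  sum-kronecker₂ A≢B G =
    ≈-trans (sum-pair 7 _ _ A≢B (λ P P≢A P≢B → ≈-trans (*-congʳ (kronecker₂-off P≢A P≢B)) (zeroˡ (G P))))
            (+-cong (≈-trans (*-congʳ (kronecker₂-left A≢B)) (*-identityˡ _))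
                    (≈-trans (*-congʳ (kronecker₂-right A≢B)) (*-identityˡ _)))

  infixl 7 _∙_
  _∙_ : Oct 𝔽 → Oct 𝔽 → Oct 𝔽
  _∙_ = _·_ 𝔽 Π ε

  norm : Oct 𝔽 → Carrier
  norm = N 𝔽 Π ε

  structure : Point → Point → Point → Carrier
  structure = structConst 𝔽 Π ε

  structure-⊕ : A ≢ B → R ≡ A ⊕ B → structure A B R ≈ sF (ε A B)
  structure-⊕ {A} {B} {R} A≢B R≡A⊕B with isSum? A B R
  ... | yes _      = ≈-refl
  ... | no ¬isSum = contradiction (subst (IsSum A B) (sym R≡A⊕B) (⊕-isSum A≢B)) ¬isSum

  structure-off : ∀ A B → R ≢ A ⊕ B → structure A B R ≈ 0#
  structure-off {R} A B R≢A⊕B with isSum? A B R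
  ... | yes isSum = contradiction (sym (isSum⇒⊕≡ isSum)) R≢A⊕B
  ... | no _      = ≈-refl

  eSum : Point → Point → Oct 𝔽
  eSum A B = oct 0# (kronecker₂ A B)

  onePlusE : Point → Oct 𝔽
  onePlusE C = oct 1# (kronecker C)

  norm-two-supported : U ≢ V → ∀ z → re z ≈ 0# → (∀ R → R ≢ U → R ≢ V → im z R ≈ 0#) →
                       norm z ≈ im z U * im z U + im z V * im z V
  norm-two-supported U≢V z re≈0 im≈0 = ≈-trans
    (+-cong (≈-trans (*-congʳ re≈0) (zeroˡ (re z)))
            (sum-pair 7 _ _ U≢V (λ R R≢U R≢V → ≈-trans (*-congʳ (im≈0 R R≢U R≢V)) (zeroˡ (im z R)))))
    (+-identityˡ _)

  norm-eSum : A ≢ B → norm (eSum A B) ≈ two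
  norm-eSum A≢B = ≈-trans (norm-two-supported A≢B _ ≈-refl (λ R → kronecker₂-off))
    (+-cong (≈-trans (*-cong (kronecker₂-left A≢B) (kronecker₂-left A≢B)) (*-identityˡ 1#))
            (≈-trans (*-cong (kronecker₂-right A≢B) (kronecker₂-right A≢B)) (*-identityˡ 1#)))

  norm-onePlusE : ∀ C → norm (onePlusE C) ≈ two
  norm-onePlusE C = +-cong (*-identityˡ 1#) (≈-trans
    (sum-single 7 C {λ P → kronecker C P * kronecker C P} (λ P P≢C → ≈-trans (*-congʳ (kronecker-≢ (≢-sym P≢C))) (zeroˡ _)))
    (≈-trans (*-cong (kronecker-refl C) (kronecker-refl C)) (*-identityˡ 1#)))

  re-eSum∙ : A ≢ B → ∀ y → im y A ≈ 0# → im y B ≈ 0# → re (eSum A B ∙ y) ≈ 0#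
  re-eSum∙ {A} {B} A≢B y imA≈0 imB≈0 = begin
    0# * re y - sumFin 𝔽 7 (λ P → kronecker₂ A B P * im y P)  ≈⟨ +-cong (zeroˡ (re y)) (-‿cong (sum-kronecker₂ A≢B (im y))) ⟩
    0# - (im y A + im y B)                                    ≈⟨ +-congˡ (-‿cong (≈-trans (+-cong imA≈0 imB≈0) (+-identityˡ 0#))) ⟩
    0# - 0#                                                   ≈⟨ -‿inverseʳ 0# ⟩
    0#                                                        ∎

  im-eSum∙ : A ≢ B → ∀ y R → im (eSum A B ∙ y) R ≈
             kronecker₂ A B R * re y + (sumFin 𝔽 7 (λ Q → im y Q * structure A Q R) + sumFin 𝔽 7 (λ Q → im y Q * structure B Q R))
  im-eSum∙ {A} {B} A≢B y R = +-cong (≈-trans (+-congʳ (zeroˡ (im y R))) (+-identityˡ _)) (begin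
    sumFin 𝔽 7 (λ P → sumFin 𝔽 7 (λ Q → structure P Q R * (kronecker₂ A B P * im y Q)))
      ≈⟨ sum-cong 7 (λ P → ≈-trans (sum-cong 7 (λ Q → reorder (structure P Q R) (kronecker₂ A B P) (im y Q)))
                                   (≈-sym (*-distribˡ-sum 7 (kronecker₂ A B P) (λ Q → im y Q * structure P Q R)))) ⟩
    sumFin 𝔽 7 (λ P → kronecker₂ A B P * sumFin 𝔽 7 (λ Q → im y Q * structure P Q R))
      ≈⟨ sum-kronecker₂ A≢B (λ P → sumFin 𝔽 7 (λ Q → im y Q * structure P Q R)) ⟩
    sumFin 𝔽 7 (λ Q → im y Q * structure A Q R) + sumFin 𝔽 7 (λ Q → im y Q * structure B Q R) ∎)
    where
    reorder : ∀ s k w → s * (k * w) ≈ k * (w * s)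
    reorder s k w = ≈-trans (*-comm s (k * w)) (*-assoc k w s)

  composition⇒isSum-opposite : IsCompositionFactor 𝔽 Π ε → ∀ {A B C} → IsSum A B C → ε B C ≡ opposite (ε A C)
  composition⇒isSum-opposite composition {A} {B} {C} s@(A≢B , C≢A , C≢B , _) =
    signs-from-norm Sign.+ (ε B C) Sign.+ (ε A C) (begin
      (1# + sF (ε B C)) * (1# + sF (ε B C)) + (1# + sF (ε A C)) * (1# + sF (ε A C))
        ≈⟨ +-cong (*-cong imA imA) (*-cong imB imB) ⟨
      im z A * im z A + im z B * im z B  ≈⟨ norm-two-supported A≢B z re≈0 im≈0 ⟨
      norm z                             ≈⟨ composition x y ⟩
      norm x * norm y                    ≈⟨ *-cong (norm-eSum A≢B) (norm-onePlusE C) ⟩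
      two * two                          ∎)
    where
    x y z : Oct 𝔽
    x = eSum A B
    y = onePlusE C
    z = x ∙ y
    A⊕C≡B : A ⊕ C ≡ B
    A⊕C≡B = isSum⇒⊕≡ (isSum-rotate (isSum-comm s))
    B⊕C≡A : B ⊕ C ≡ A
    B⊕C≡A = isSum⇒⊕≡ (isSum-rotate s)
    re≈0 : re z ≈ 0#
    re≈0 = re-eSum∙ A≢B y (kronecker-≢ C≢A) (kronecker-≢ C≢B)
    im≈ : ∀ R → im z R ≈ kronecker₂ A B R + (structure A C R + structure B C R)
    im≈ R = ≈-trans (im-eSum∙ A≢B y R)
      (+-cong (*-identityʳ _) (+-cong (sum-kronecker C (λ Q → structure A Q R)) (sum-kronecker C (λ Q → structure B Q R))))
    imA : im z A ≈ 1# + sF (ε B C)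
    imA = ≈-trans (im≈ A) (+-cong (kronecker₂-left A≢B)
      (≈-trans (+-cong (structure-off A C (A≢B ∘ λ eq → trans eq A⊕C≡B)) (structure-⊕ (≢-sym C≢B) (sym B⊕C≡A)))
               (+-identityˡ _)))
    imB : im z B ≈ 1# + sF (ε A C)
    imB = ≈-trans (im≈ B) (+-cong (kronecker₂-right A≢B)
      (≈-trans (+-cong (structure-⊕ (≢-sym C≢A) (sym A⊕C≡B)) (structure-off B C (≢-sym A≢B ∘ λ eq → trans eq B⊕C≡A)))
               (+-identityʳ _)))
    im≈0 : ∀ R → R ≢ A → R ≢ B → im z R ≈ 0#
    im≈0 R R≢A R≢B = ≈-trans (im≈ R) (≈-trans (+-cong (kronecker₂-off R≢A R≢B)
      (≈-trans (+-cong (structure-off A C (R≢B ∘ λ eq → trans eq A⊕C≡B)) (structure-off B C (R≢A ∘ λ eq → trans eq B⊕C≡A)))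
               (+-identityˡ 0#))) (+-identityˡ 0#))

  composition⇒quadrangleRule : IsCompositionFactor 𝔽 Π ε → QuadrangleRule Π ε
  composition⇒quadrangleRule composition {A} {B} {C} {D} q =
    signs-from-norm (ε A C) (ε B D) (ε A D) (ε B C) (begin
      (sF (ε A C) + sF (ε B D)) * (sF (ε A C) + sF (ε B D)) + (sF (ε A D) + sF (ε B C)) * (sF (ε A D) + sF (ε B C))
                                         ≈⟨ +-cong (*-cong imX imX) (*-cong imY imY) ⟨
      im z X * im z X + im z Y * im z Y  ≈⟨ norm-two-supported X≢Y z re≈0 im≈0 ⟨
      norm z                             ≈⟨ composition x y ⟩
      norm x * norm y                    ≈⟨ *-cong (norm-eSum A≢B) (norm-eSum C≢D) ⟩
      two * two                          ∎)
    where
    open Quadrangle q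
    x y z : Oct 𝔽
    x = eSum A B
    y = eSum C D
    z = x ∙ y
    X Y : Point
    X = A ⊕ C
    Y = A ⊕ D
    X≢Y : X ≢ Y
    X≢Y = C≢D ∘ ⊕-injectiveʳ A
    re≈0 : re z ≈ 0#
    re≈0 = re-eSum∙ A≢B y (kronecker₂-off A≢C A≢D) (kronecker₂-off B≢C B≢D)
    im≈ : ∀ R → im z R ≈ (structure A C R + structure A D R) + (structure B C R + structure B D R)
    im≈ R = ≈-trans (im-eSum∙ A≢B y R) (≈-trans
      (+-cong (zeroʳ _) (+-cong (sum-kronecker₂ C≢D (λ Q → structure A Q R)) (sum-kronecker₂ C≢D (λ Q → structure B Q R))))
      (+-identityˡ _))
    R≢B⊕C : ∀ {R} → R ≢ Y → R ≢ B ⊕ C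
    R≢B⊕C R≢Y eq = R≢Y (trans eq (sym A⊕D≡B⊕C))
    R≢B⊕D : ∀ {R} → R ≢ X → R ≢ B ⊕ D
    R≢B⊕D R≢X eq = R≢X (trans eq (sym A⊕C≡B⊕D))
    imX : im z X ≈ sF (ε A C) + sF (ε B D)
    imX = ≈-trans (im≈ X) (+-cong
      (≈-trans (+-cong (structure-⊕ A≢C refl) (structure-off A D X≢Y)) (+-identityʳ _))
      (≈-trans (+-cong (structure-off B C (R≢B⊕C X≢Y)) (structure-⊕ B≢D A⊕C≡B⊕D)) (+-identityˡ _)))
    imY : im z Y ≈ sF (ε A D) + sF (ε B C)
    imY = ≈-trans (im≈ Y) (+-cong
      (≈-trans (+-cong (structure-off A C (≢-sym X≢Y)) (structure-⊕ A≢D refl)) (+-identityˡ _))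
      (≈-trans (+-cong (structure-⊕ B≢C A⊕D≡B⊕C) (structure-off B D (R≢B⊕D (≢-sym X≢Y)))) (+-identityʳ _)))
    im≈0 : ∀ R → R ≢ X → R ≢ Y → im z R ≈ 0#
    im≈0 R R≢X R≢Y = ≈-trans (im≈ R) (≈-trans
      (+-cong (≈-trans (+-cong (structure-off A C R≢X) (structure-off A D R≢Y)) (+-identityˡ 0#))
              (≈-trans (+-cong (structure-off B C (R≢B⊕C R≢Y)) (structure-off B D (R≢B⊕D R≢X))) (+-identityˡ 0#)))
      (+-identityˡ 0#))

-- Imported only now: with the constructor + in scope, ring terms x + y would no longer parse.
open import Data.Sign using (+)

corollary2p30 : ∀ {c ℓ : Level} (𝔽 : Field c ℓ) → CharNot2 𝔽 →
  (Π : FanoPlane) (ε : Point → Point → Sign) →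
  IsMultiplicationFactor ε → IsCompositionFactor 𝔽 Π ε →
  (P : Point) (D₁ D₂ D₃ : Fin 7) →
  D₁ ≢ D₂ → D₁ ≢ D₃ → D₂ ≢ D₃ →
  P ∈ FanoPlane.line Π D₁ → P ∈ FanoPlane.line Π D₂ → P ∈ FanoPlane.line Π D₃ →
  (g : Aut Π) →
  (A₁ B₁ A₂ B₂ A₃ B₃ : Point) →
  A₁ ≢ B₁ → A₁ ∈ FanoPlane.line Π D₁ → B₁ ∈ FanoPlane.line Π D₁ →
  A₂ ≢ B₂ → A₂ ∈ FanoPlane.line Π D₂ → B₂ ∈ FanoPlane.line Π D₂ →
  A₃ ≢ B₃ → A₃ ∈ FanoPlane.line Π D₃ → B₃ ∈ FanoPlane.line Π D₃ →
  (δ* {Π} ε g A₁ B₁ Sign.* δ* {Π} ε g A₂ B₂) Sign.* δ* {Π} ε g A₃ B₃ ≡ +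
corollary2p30 𝔽 char≢2 Π ε ε-antisym composition =
  pencil-δ*-product ε-antisym
    (antisym⇒rotationRule Π ε ε-antisym (composition⇒isSum-opposite composition))
    (composition⇒quadrangleRule composition)
  where open CompositionFactor 𝔽 char≢2 Π ε
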